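{- Let $G$ be a $K_4$-minor-free graph, let $C$ be a positive integer, and let $H$ be a $C$-pocket of $G$ whose coboundary has size $1$. Then for every list assignment $L$ of $H$ such that $|L(v)|\ge 2$ for every vertex $v$ in the boundary of $H$ and $|L(v)| \ge 4$ for every other vertex $v$ of $H$, $H$ has an $L$-colouring.
   Context: For an induced subgraph $H$ of $G$, the boundary of $H$ is the set of vertices of $H$ having a neighbour outside $V(H)$; the coboundary of $H$ is the set of vertices of $G - V(H)$ having a neighbour in $V(H)$. For $C>0$, $H$ is a $C$-pocket if $H$ is a connected induced subgraph, $v(H)\le C$, and $d_G(v)\le C$ for every $v\in V(H)$. An $L$-colouring is a proper colouring $f$ with $f(v)\in L(v)$. -}

module Defs where

open import Data.Nat using (ℕ; _≤_; _≥_)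
open import Data.Fin using (Fin)
open import Data.Bool using (Bool; T; true; false; not)
open import Data.List using (List; length; filterᵇ; allFin)
open import Data.List.Membership.Propositional using (_∈_)
open import Data.List.Relation.Unary.Unique.Propositional using (Unique)
open import Data.Product using (Σ; ∃; _×_; _,_)
open import Relation.Binary.PropositionalEquality using (_≡_; _≢_)
open import Relation.Nullary using (¬_)

record Graph (n : ℕ) : Set where
  field
    adj     : Fin n → Fin n → Bool
    symm    : ∀ u v → adj u v ≡ adj v u
    irrefl  : ∀ v → adj v v ≡ false
open Graph public

VSet : ℕ → Set
VSet n = Fin n → Bool

_∈ₛ_ : ∀ {n} → Fin n → VSet n → Set
v ∈ₛ S = T (S v)

_∉ₛ_ : ∀ {n} → Fin n → VSet n → Set
v ∉ₛ S = ¬ (v ∈ₛ S)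

Adj : ∀ {n} → Graph n → Fin n → Fin n → Set
Adj G u v = T (adj G u v)

size : ∀ {n} → VSet n → ℕ
size {n} S = length (filterᵇ S (allFin n))

degree : ∀ {n} → Graph n → Fin n → ℕ
degree {n} G v = length (filterᵇ (adj G v) (allFin n))

data WalkIn {n} (G : Graph n) (S : VSet n) : Fin n → Fin n → Set where
  here : ∀ {v} → v ∈ₛ S → WalkIn G S v v
  step : ∀ {u w v} → u ∈ₛ S → Adj G u w → WalkIn G S w v → WalkIn G S u v

Connected : ∀ {n} → Graph n → VSet n → Set
Connected {n} G S =
  (∃ λ v → v ∈ₛ S) × (∀ u v → u ∈ₛ S → v ∈ₛ S → WalkIn G S u v)

Disjoint : ∀ {n} → VSet n → VSet n → Set
Disjoint {n} A B = ∀ (v : Fin n) → v ∈ₛ A → v ∉ₛ B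

HasK4Minor : ∀ {n} → Graph n → Set
HasK4Minor {n} G = Σ (Fin 4 → VSet n) λ B →
    (∀ i → Connected G (B i))
  × (∀ i j → i ≢ j → Disjoint (B i) (B j))
  × (∀ i j → i ≢ j → ∃ λ u → ∃ λ v → u ∈ₛ B i × v ∈ₛ B j × Adj G u v)

K4MinorFree : ∀ {n} → Graph n → Set
K4MinorFree G = ¬ HasK4Minor G

IsPocket : ∀ {n} → Graph n → ℕ → VSet n → Set
IsPocket G C S =
  Connected G S × size S ≤ C × (∀ v → v ∈ₛ S → degree G v ≤ C)

InBoundary : ∀ {n} → Graph n → VSet n → Fin n → Set
InBoundary G S v = v ∈ₛ S × ∃ λ w → w ∉ₛ S × Adj G v w

InCoboundary : ∀ {n} → Graph n → VSet n → Fin n → Set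
InCoboundary G S w = w ∉ₛ S × ∃ λ v → v ∈ₛ S × Adj G w v

CoboundarySizeOne : ∀ {n} → Graph n → VSet n → Set
CoboundarySizeOne G S =
  ∃ λ w → InCoboundary G S w × (∀ x → InCoboundary G S x → x ≡ w)

ListAssignment : ℕ → Set
ListAssignment n = Fin n → List ℕ

IsLColouring : ∀ {n} → Graph n → VSet n → ListAssignment n → (Fin n → ℕ) → Set
IsLColouring G S L f =
    (∀ v → v ∈ₛ S → f v ∈ L v)
  × (∀ u v → u ∈ₛ S → v ∈ₛ S → Adj G u v → f u ≢ f v)

-- The pocket is coloured greedily: a vertex with fewer neighbours among the
-- still uncoloured vertices than colours in its list can always be coloured last.
-- If no such vertex exists in a set Y of pocket vertices, every vertex of Y has at
-- least three neighbours in Y ∪ {w}, where w is the coboundary vertex: a boundary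
-- vertex has at least two in Y and is adjacent to w, an interior one at least four.
-- Such a graph has a K₄ minor, by a longest-path argument.  Grow a path from Y,
-- ending in w if w has a neighbour in Y, until its head q has all neighbours on it:
-- q P qa R, with q adjacent to qa and to a vertex of R.  If P sends an edge to R,
-- then {q}, P, qa R₁ and d R₂ are the branch sets of a K₄ minor, where d is the
-- first vertex of R adjacent to q or P.  Otherwise reversing q P gives a path of the
-- same length whose new head has all its neighbours in P q qa, so that the segment
-- playing the role of P gets shorter, and the argument repeats.

{-# OPTIONS --safe #-}
module Submission where

open import Defs
open import Data.Nat using (ℕ; zero; suc; _≤_; _≥_; _<_; _+_; z≤n; s≤s; _<?_) renaming (_≟_ to _≟ℕ_)
open import Data.Nat.Properties
open import Data.Fin using (Fin) renaming (_≟_ to _≟ᶠ_)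
open import Data.Fin.Patterns using (0F; 1F; 2F; 3F)
open import Data.Bool using (T)
open import Data.List using (List; []; _∷_; _++_; length; filter; filterᵇ; allFin; map; reverse; _ʳ++_)
open import Data.List.Properties
  using (++-assoc; length-++; length-map; length-reverse; ʳ++-defn; filter-notAll; filter-accept; filter-reject)
open import Data.List.Membership.Propositional using (_∈_; _∉_; find; lose)
open import Data.List.Membership.Propositional.Properties
  using (∈-++⁺ˡ; ∈-++⁺ʳ; ∈-++⁻; ∈-∃++; ∈-filter⁺; ∈-filter⁻; ∈-allFin; ∈-map⁺)
import Data.List.Membership.DecPropositional as DecMembership
open DecMembership _≟ℕ_ using () renaming (_∈?_ to _∈ℕ?_)
open import Data.List.Relation.Binary.Subset.Propositional using (_⊆_)
open import Data.List.Relation.Binary.Permutation.Propositional using (_↭_; ↭-sym; ↭-trans; ↭⇒↭ₛ)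
open import Data.List.Relation.Binary.Permutation.Propositional.Properties
  using (∈-resp-↭; All-resp-↭; ↭-length; ↭-reverse; shift; ++⁺ʳ)
import Data.List.Relation.Binary.Permutation.Setoid.Properties as PermutationSetoid
open import Data.List.Relation.Unary.Any using (Any; here; there; any?)
import Data.List.Relation.Unary.Any as Any
import Data.List.Relation.Unary.Any.Properties as Any
open import Data.List.Relation.Unary.All using (All; []; _∷_; all?)
import Data.List.Relation.Unary.All as All
open import Data.List.Relation.Unary.All.Properties using (¬All⇒Any¬; All¬⇒¬Any; ¬Any⇒All¬)
open import Data.List.Relation.Unary.Linked using (Linked; []; [-]; _∷_)
import Data.List.Relation.Unary.Linked as Linked
import Data.List.Relation.Unary.First as First
open import Data.List.Relation.Unary.First.Properties using (toView)
open import Data.List.Relation.Unary.Unique.Propositional using (Unique)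
open import Data.List.Relation.Unary.AllPairs using ([]; _∷_)
open import Data.List.Relation.Unary.Unique.Propositional.Properties using (Unique[x∷xs]⇒x∉xs; allFin⁺)
import Data.List.Relation.Unary.Unique.Propositional.Properties as Unique
open import Data.Product using (∃; ∃₂; _×_; _,_; proj₁; proj₂)
import Data.Product as Product
open import Data.Sum using (_⊎_; inj₁; inj₂)
import Data.Sum as Sum
open import Relation.Nullary using (¬_; Dec; yes; no; contradiction)
open import Relation.Nullary.Decidable using (⌊_⌋; T?; ¬?; toSum; toWitness; fromWitness)
open import Relation.Unary using (Pred; Decidable; ∁)
open import Function using (_∘_)
open import Relation.Binary.Definitions using (DecidableEquality; Symmetric)
open import Relation.Binary.PropositionalEquality
  using (_≡_; _≢_; refl; sym; trans; cong; subst; setoid; module ≡-Reasoning)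
open import Level using (0ℓ)

module _ {A : Set} where

  Unique-++⁻ʳ : ∀ xs {ys : List A} → Unique (xs ++ ys) → Unique ys
  Unique-++⁻ʳ []       u       = u
  Unique-++⁻ʳ (x ∷ xs) (_ ∷ u) = Unique-++⁻ʳ xs u

  Unique-++⇒∉ : ∀ xs {ys : List A} {x} → Unique (xs ++ ys) → x ∈ xs → x ∉ ys
  Unique-++⇒∉ (_ ∷ xs) u       (here refl)  x∈ys = Unique[x∷xs]⇒x∉xs u (∈-++⁺ʳ xs x∈ys)
  Unique-++⇒∉ (_ ∷ xs) (_ ∷ u) (there x∈xs) x∈ys = Unique-++⇒∉ xs u x∈xs x∈ys

  Unique-resp-↭ : ∀ {xs ys : List A} → xs ↭ ys → Unique xs → Unique ys
  Unique-resp-↭ σ = PermutationSetoid.Unique-resp-↭ (setoid A) (↭⇒↭ₛ σ)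

  Unique-⊆⇒length≤ : ∀ {xs ys : List A} → Unique xs → xs ⊆ ys → length xs ≤ length ys
  Unique-⊆⇒length≤ {[]}     _          _     = z≤n
  Unique-⊆⇒length≤ {x ∷ xs} (x≢xs ∷ u) xs⊆ys with ∈-∃++ (xs⊆ys (here refl))
  ... | ys₁ , ys₂ , refl = begin
    suc (length xs)           ≤⟨ s≤s (Unique-⊆⇒length≤ u xs⊆ys₁++ys₂) ⟩
    suc (length (ys₁ ++ ys₂)) ≡⟨ ↭-length (shift x ys₁ ys₂) ⟨
    length (ys₁ ++ x ∷ ys₂)   ∎
    where
    open ≤-Reasoning
    xs⊆ys₁++ys₂ : xs ⊆ ys₁ ++ ys₂
    xs⊆ys₁++ys₂ z∈xs with ∈-resp-↭ (shift x ys₁ ys₂) (xs⊆ys (there z∈xs))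
    ... | here z≡x = contradiction (sym z≡x) (All.lookup x≢xs z∈xs)
    ... | there z∈ = z∈

  reverse-∷ : ∀ (x : A) xs → ∃₂ λ u M → reverse (x ∷ xs) ≡ u ∷ M
  reverse-∷ x xs with reverse (x ∷ xs) in eq
  ... | u ∷ M = u , M , refl
  ... | []    = contradiction (trans (sym (length-reverse (x ∷ xs))) (cong length eq)) λ ()

  length-++-∷-Any : ∀ {P : Pred A 0ℓ} xs {y ys} → Any P ys → 2 + length xs ≤ length (xs ++ y ∷ ys)
  length-++-∷-Any []       {ys = _ ∷ _} _ = s≤s (s≤s z≤n)
  length-++-∷-Any (_ ∷ xs)              a = s≤s (length-++-∷-Any xs a)

  ∈-++-∉ʳ : ∀ {x : A} xs {ys} → x ∈ xs ++ ys → x ∉ ys → x ∈ xs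
  ∈-++-∉ʳ xs x∈ x∉ys = Sum.[ (λ x∈xs → x∈xs) , (λ x∈ys → contradiction x∈ys x∉ys) ]′ (∈-++⁻ xs x∈)

module _ {A : Set} {R : A → A → Set} where

  Linked-++⁻ : ∀ xs {ys : List A} → Linked R (xs ++ ys) → Linked R xs × Linked R ys
  Linked-++⁻ []                     l       = [] , l
  Linked-++⁻ (_ ∷ [])      {[]}     l       = [-] , []
  Linked-++⁻ (_ ∷ [])      {_ ∷ _}  (_ ∷ l) = [-] , l
  Linked-++⁻ (_ ∷ x′ ∷ xs)          (r ∷ l) = Product.map₁ (r ∷_) (Linked-++⁻ (x′ ∷ xs) l)

  Linked-ʳ++ : Symmetric R →
               ∀ {x} xs {ys : List A} → Linked R (x ∷ xs) → Linked R (x ∷ ys) → Linked R (xs ʳ++ x ∷ ys)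
  Linked-ʳ++ R-sym []       _       l′ = l′
  Linked-ʳ++ R-sym (y ∷ xs) (r ∷ l) l′ = Linked-ʳ++ R-sym xs l (R-sym r ∷ l′)

module _ {A : Set} {P : Pred A 0ℓ} (P? : Decidable P) where

  splitAtFirst : ∀ {xs} → Any P xs → ∃₂ λ B q → ∃ λ R → xs ≡ B ++ q ∷ R × All (∁ P) B × P q
  splitAtFirst {xs} pxs with First.first (λ x → Sum.swap (toSum (P? x))) xs
  ... | inj₂ none = contradiction pxs (All¬⇒¬Any none)
  ... | inj₁ fst with toView fst
  ... | First._++_∷_ notP pq R = _ , _ , R , refl , notP , pq

  ∈-++⁻-All∁ : ∀ B {q R x} → All (∁ P) B → x ∈ B ++ q ∷ R → P x → x ∈ q ∷ R
  ∈-++⁻-All∁ B notP x∈ px =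
    Sum.[ (λ x∈B → contradiction px (All.lookup notP x∈B)) , (λ x∈qR → x∈qR) ]′ (∈-++⁻ B x∈)

  splitAtFirstOfTwo : ∀ {a b xs} → a ≢ b → a ∈ xs → b ∈ xs → P a → P b →
                      ∃₂ λ B q → ∃ λ R → xs ≡ B ++ q ∷ R × P q × Any P R
  splitAtFirstOfTwo a≢b a∈xs b∈xs pa pb with splitAtFirst (lose a∈xs pa)
  ... | B , q , R , refl , notP , pq with ∈-++⁻-All∁ B notP a∈xs pa | ∈-++⁻-All∁ B notP b∈xs pb
  ... | there a∈R | _         = B , q , R , refl , pq , lose a∈R pa
  ... | here refl | there b∈R = B , q , R , refl , pq , lose b∈R pb
  ... | here refl | here refl = contradiction refl a≢b

module _ {A : Set} (_≟_ : DecidableEquality A) where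

  twoMembersAvoiding : ∀ {xs} → Unique xs → 3 ≤ length xs → ∀ y →
                       ∃₂ λ a b → a ≢ b × a ≢ y × b ≢ y × a ∈ xs × b ∈ xs
  twoMembersAvoiding {a ∷ b ∷ c ∷ _} ((a≢b ∷ a≢c ∷ _) ∷ (b≢c ∷ _) ∷ _) _ y with a ≟ y | b ≟ y
  ... | yes refl | _        = b , c , b≢c , a≢b ∘ sym , a≢c ∘ sym , there (here refl) , there (there (here refl))
  ... | no a≢y   | yes refl = a , c , a≢c , a≢y , b≢c ∘ sym , here refl , there (there (here refl))
  ... | no a≢y   | no b≢y   = a , b , a≢b , a≢y , b≢y , here refl , there (here refl)
  twoMembersAvoiding {_ ∷ []}     _ (s≤s ())
  twoMembersAvoiding {_ ∷ _ ∷ []} _ (s≤s (s≤s ()))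

module _ {ℓ} {R : Fin 4 → Fin 4 → Set ℓ} (R-sym : ∀ {i j} → R i j → R j i) where

  Fin4-pairwise : R 0F 1F → R 0F 2F → R 0F 3F → R 1F 2F → R 1F 3F → R 2F 3F → ∀ i j → i ≢ j → R i j
  Fin4-pairwise r₀₁ r₀₂ r₀₃ r₁₂ r₁₃ r₂₃ = table
    where
    table : ∀ i j → i ≢ j → R i j
    table 0F 1F _ = r₀₁
    table 0F 2F _ = r₀₂
    table 0F 3F _ = r₀₃
    table 1F 2F _ = r₁₂
    table 1F 3F _ = r₁₃
    table 2F 3F _ = r₂₃
    table 1F 0F _ = R-sym r₀₁
    table 2F 0F _ = R-sym r₀₂
    table 3F 0F _ = R-sym r₀₃
    table 2F 1F _ = R-sym r₁₂
    table 3F 1F _ = R-sym r₁₃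
    table 3F 2F _ = R-sym r₂₃
    table 0F 0F i≢i = contradiction refl i≢i
    table 1F 1F i≢i = contradiction refl i≢i
    table 2F 2F i≢i = contradiction refl i≢i
    table 3F 3F i≢i = contradiction refl i≢i

toVSet : ∀ {n} → List (Fin n) → VSet n
toVSet xs v = ⌊ v ∈? xs ⌋
  where open DecMembership _≟ᶠ_

module _ {n : ℕ} {xs : List (Fin n)} {v : Fin n} where
  open DecMembership (_≟ᶠ_ {n}) using (_∈?_)

  ∈ₛ-toVSet⁺ : v ∈ xs → v ∈ₛ toVSet xs
  ∈ₛ-toVSet⁺ = fromWitness {a? = v ∈? xs}

  ∈ₛ-toVSet⁻ : v ∈ₛ toVSet xs → v ∈ xs
  ∈ₛ-toVSet⁻ = toWitness {a? = v ∈? xs}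

module _ {n : ℕ} (G : Graph n) where

  Adj-sym : ∀ {u v} → Adj G u v → Adj G v u
  Adj-sym {u} {v} = subst T (symm G u v)

  Adj-irrefl : ∀ {v} → ¬ Adj G v v
  Adj-irrefl {v} = subst T (irrefl G v)

  Adj? : ∀ u v → Dec (Adj G u v)
  Adj? u v = T? (adj G u v)

  AdjToSome? : ∀ X → Decidable (λ v → Any (λ x → Adj G x v) X)
  AdjToSome? X v = any? (λ x → Adj? x v) X

  degreeIn : List (Fin n) → Fin n → ℕ
  degreeIn X v = length (filterᵇ (adj G v) X)

  Joined : List (Fin n) → List (Fin n) → Set
  Joined X Y = ∃₂ λ x y → x ∈ X × y ∈ Y × Adj G x y

  WalkIn-∷ʳ : ∀ {S u v z} → WalkIn G S u v → Adj G v z → z ∈ₛ S → WalkIn G S u z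
  WalkIn-∷ʳ (here v∈S)        v~z z∈S = step v∈S v~z (here z∈S)
  WalkIn-∷ʳ (step u∈S u~x wk) v~z z∈S = step u∈S u~x (WalkIn-∷ʳ wk v~z z∈S)

  Linked⇒WalkIn : ∀ {S xs} → Linked (Adj G) xs → (∀ {y} → y ∈ xs → y ∈ₛ S) →
                  ∀ {u v} → u ∈ xs → v ∈ xs → WalkIn G S u v
  Linked⇒WalkIn l         ⊆S (here refl) (here refl) = here (⊆S (here refl))
  Linked⇒WalkIn (r ∷ l)   ⊆S (here refl) (there v∈) =
    step (⊆S (here refl)) r (Linked⇒WalkIn l (⊆S ∘ there) (here refl) v∈)
  Linked⇒WalkIn (r ∷ l)   ⊆S (there u∈) (here refl) =
    WalkIn-∷ʳ (Linked⇒WalkIn l (⊆S ∘ there) u∈ (here refl)) (Adj-sym r) (⊆S (here refl))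
  Linked⇒WalkIn (_ ∷ l)   ⊆S (there u∈) (there v∈) = Linked⇒WalkIn l (⊆S ∘ there) u∈ v∈

  Linked-++⇒Joined : ∀ x xs {y ys zs} → Linked (Adj G) (x ∷ xs ++ y ∷ ys) → Joined (x ∷ xs) (y ∷ zs)
  Linked-++⇒Joined x []        (r ∷ _) = x , _ , here refl , here refl , r
  Linked-++⇒Joined x (x′ ∷ xs) (_ ∷ l) with Linked-++⇒Joined x′ xs l
  ... | a , b , a∈ , b∈ , a~b = a , b , there a∈ , b∈ , a~b

  Linked⇒Connected : ∀ {xs} → ∃ (_∈ xs) → Linked (Adj G) xs → Connected G (toVSet xs)
  Linked⇒Connected (x , x∈) l =
    (x , ∈ₛ-toVSet⁺ x∈) , λ _ _ u∈ v∈ → Linked⇒WalkIn l ∈ₛ-toVSet⁺ (∈ₛ-toVSet⁻ u∈) (∈ₛ-toVSet⁻ v∈)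

  K4Minor-fromSegments : ∀ X₀ X₁ X₂ X₃ → Unique (X₀ ++ X₁ ++ X₂ ++ X₃) →
    Linked (Adj G) X₀ → Linked (Adj G) X₁ → Linked (Adj G) X₂ → Linked (Adj G) X₃ →
    Joined X₀ X₁ → Joined X₀ X₂ → Joined X₀ X₃ → Joined X₁ X₂ → Joined X₁ X₃ → Joined X₂ X₃ →
    HasK4Minor G
  K4Minor-fromSegments X₀ X₁ X₂ X₃ u l₀ l₁ l₂ l₃ j₀₁ j₀₂ j₀₃ j₁₂ j₁₃ j₂₃ =
    B , connected ,
    Fin4-pairwise (λ d v v∈j v∈i → d v v∈i v∈j)
      (disjoint X₀ u ∈-++⁺ˡ) (disjoint X₀ u (∈-++⁺ʳ X₁ ∘ ∈-++⁺ˡ))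
      (disjoint X₀ u (∈-++⁺ʳ X₁ ∘ ∈-++⁺ʳ X₂)) (disjoint X₁ u₁ ∈-++⁺ˡ)
      (disjoint X₁ u₁ (∈-++⁺ʳ X₂)) (disjoint X₂ u₂ (λ x∈ → x∈)) ,
    Fin4-pairwise (λ (x , y , x∈ , y∈ , x~y) → y , x , y∈ , x∈ , Adj-sym x~y)
      (joined j₀₁) (joined j₀₂) (joined j₀₃) (joined j₁₂) (joined j₁₃) (joined j₂₃)
    where
    X : Fin 4 → List (Fin n)
    X 0F = X₀
    X 1F = X₁
    X 2F = X₂
    X 3F = X₃

    B : Fin 4 → VSet n
    B i = toVSet (X i)

    u₁ : Unique (X₁ ++ X₂ ++ X₃)
    u₁ = Unique-++⁻ʳ X₀ u
    u₂ : Unique (X₂ ++ X₃)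
    u₂ = Unique-++⁻ʳ X₁ u₁

    disjoint : ∀ Y {Z W} → Unique (Y ++ Z) → W ⊆ Z → Disjoint (toVSet Y) (toVSet W)
    disjoint Y u W⊆Z v v∈Y v∈W = Unique-++⇒∉ Y u (∈ₛ-toVSet⁻ v∈Y) (W⊆Z (∈ₛ-toVSet⁻ v∈W))

    joined : ∀ {Y Z} → Joined Y Z → ∃ λ y → ∃ λ z → y ∈ₛ toVSet Y × z ∈ₛ toVSet Z × Adj G y z
    joined (y , z , y∈ , z∈ , y~z) = y , z , ∈ₛ-toVSet⁺ y∈ , ∈ₛ-toVSet⁺ z∈ , y~z

    source : ∀ {Y Z} → Joined Y Z → ∃ (_∈ Y)
    source (y , _ , y∈ , _) = y , y∈

    target : ∀ {Y Z} → Joined Y Z → ∃ (_∈ Z)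
    target (_ , z , _ , z∈ , _) = z , z∈

    connected : ∀ i → Connected G (B i)
    connected 0F = Linked⇒Connected (source j₀₁) l₀
    connected 1F = Linked⇒Connected (source j₁₂) l₁
    connected 2F = Linked⇒Connected (source j₂₃) l₂
    connected 3F = Linked⇒Connected (target j₂₃) l₃

module K4FromMinDegree {n : ℕ} (G : Graph n) (w : Fin n) (T : List (Fin n))
                       (w∷T-unique : Unique (w ∷ T)) where

  open DecMembership (_≟ᶠ_ {n}) using (_∈?_)

  N : Fin n → List (Fin n)
  N v = filterᵇ (adj G v) (w ∷ T)

  N-unique : ∀ v → Unique (N v)
  N-unique v = Unique.filter⁺ (T? ∘ adj G v) w∷T-unique

  N-adjacent : ∀ {v x} → x ∈ N v → Adj G v x
  N-adjacent {v} x∈N = proj₂ (∈-filter⁻ (T? ∘ adj G v) {xs = w ∷ T} x∈N)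

  N-⊆-tail : ∀ {v Q} → N v ⊆ v ∷ Q → N v ⊆ Q
  N-⊆-tail {v} N⊆ x∈N = Any.tail (λ x≡v → Adj-irrefl G (subst (Adj G v) x≡v (N-adjacent x∈N))) (N⊆ x∈N)

  -- w may only occur as the last vertex of a path, as it alone may have degree below three.
  data ThroughT : List (Fin n) → Set where
    []  : ThroughT []
    [w] : ThroughT (w ∷ [])
    _∷_ : ∀ {x xs} → x ∈ T → ThroughT xs → ThroughT (x ∷ xs)

  ThroughT⇒⊆ : ∀ {Q} → ThroughT Q → Q ⊆ w ∷ T
  ThroughT⇒⊆ [w]       (here refl) = here refl
  ThroughT⇒⊆ (x∈T ∷ _) (here refl) = there x∈T
  ThroughT⇒⊆ (_ ∷ tQ)  (there y∈Q) = ThroughT⇒⊆ tQ y∈Q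

  ThroughT-++⁻ : ∀ xs {y ys} → ThroughT (xs ++ y ∷ ys) → All (_∈ T) xs × ThroughT (y ∷ ys)
  ThroughT-++⁻ []            tQ         = [] , tQ
  ThroughT-++⁻ (_ ∷ [])      (x∈T ∷ tQ) = x∈T ∷ [] , tQ
  ThroughT-++⁻ (_ ∷ x′ ∷ xs) (x∈T ∷ tQ) = Product.map₁ (x∈T ∷_) (ThroughT-++⁻ (x′ ∷ xs) tQ)

  ThroughT-++⁺ : ∀ {xs ys} → All (_∈ T) xs → ThroughT ys → ThroughT (xs ++ ys)
  ThroughT-++⁺ []          tQ = tQ
  ThroughT-++⁺ (x∈T ∷ xs⊆T) tQ = x∈T ∷ ThroughT-++⁺ xs⊆T tQ

  record IsTPath (Q : List (Fin n)) : Set where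
    field
      unique  : Unique Q
      linked  : Linked (Adj G) Q
      through : ThroughT Q
      -- so a neighbour of the head that lies off the path is in T
      w-safe  : w ∈ Q ⊎ (∀ {v} → v ∈ T → ¬ Adj G v w)
  open IsTPath

  IsTPath-length≤ : ∀ {Q} → IsTPath Q → length Q ≤ length (w ∷ T)
  IsTPath-length≤ p = Unique-⊆⇒length≤ (unique p) (ThroughT⇒⊆ (through p))

  Extends : Fin n → List (Fin n) → Set
  Extends q Q = ∃ λ x → x ∈ T × x ∉ Q × Adj G q x

  extend : ∀ {q Q x} → IsTPath (q ∷ Q) → x ∈ T → x ∉ q ∷ Q → Adj G q x → IsTPath (x ∷ q ∷ Q)
  extend p x∈T x∉Q q~x = record
    { unique  = ¬Any⇒All¬ _ x∉Q ∷ unique p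
    ; linked  = Adj-sym G q~x ∷ linked p
    ; through = x∈T ∷ through p
    ; w-safe  = Sum.map₁ there (w-safe p)
    }

  extends-or-N⊆ : ∀ {q Q} → IsTPath Q → q ∈ T → Extends q Q ⊎ N q ⊆ Q
  extends-or-N⊆ {q} {Q} p q∈T with all? (_∈? Q) (N q)
  ... | yes N⊆Q = inj₂ (All.lookup N⊆Q)
  ... | no N⊈Q with find (¬All⇒Any¬ (_∈? Q) (N q) N⊈Q)
  ... | x , x∈N , x∉Q with ∈-filter⁻ (T? ∘ adj G q) {xs = w ∷ T} x∈N
  ... | there x∈T , q~x = inj₁ (x , x∈T , x∉Q , q~x)
  ... | here refl , q~w =
    Sum.[ (λ w∈Q → contradiction w∈Q x∉Q) , (λ noNeighbour → contradiction q~w (noNeighbour q∈T)) ]′ (w-safe p)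

  chordAt : ∀ {q} Z → 3 ≤ length (N q) → N q ⊆ Z →
            ∃₂ λ y B → ∃₂ λ qa R → Z ≡ y ∷ B ++ qa ∷ R × Adj G q qa × Any (Adj G q) R
  chordAt {q} [] deg N⊆[] with twoMembersAvoiding _≟ᶠ_ (N-unique q) deg w
  ... | _ , _ , _ , _ , _ , a∈N , _ with N⊆[] a∈N
  ... | ()
  chordAt {q} (y ∷ ys) deg N⊆Z with twoMembersAvoiding _≟ᶠ_ (N-unique q) deg y
  ... | a , b , a≢b , a≢y , b≢y , a∈N , b∈N
    with splitAtFirstOfTwo (Adj? G q) a≢b (Any.tail a≢y (N⊆Z a∈N)) (Any.tail b≢y (N⊆Z b∈N))
           (N-adjacent a∈N) (N-adjacent b∈N)
  ... | B , qa , R , refl , q~qa , chord = y , B , qa , R , refl , q~qa , chord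

  record ChordedPath (q : Fin n) (P : List (Fin n)) (qa : Fin n) (R : List (Fin n)) : Set where
    field
      path  : IsTPath (q ∷ P ++ qa ∷ R)
      q∈T   : q ∈ T
      q~qa  : Adj G q qa
      chord : Any (Adj G q) R
  open ChordedPath

  ChordedPath-P⊆T : ∀ {q P qa R} → ChordedPath q P qa R → All (_∈ T) P
  ChordedPath-P⊆T {q} {P} cp = All.tail (proj₁ (ThroughT-++⁻ (q ∷ P) (through (path cp))))

  chordedPathAtHead : ∀ {q Q} → IsTPath (q ∷ Q) → q ∈ T → 3 ≤ length (N q) → N q ⊆ q ∷ Q →
                      ∃₂ λ b B → ∃₂ λ qa R → Q ≡ b ∷ B ++ qa ∷ R × ChordedPath q (b ∷ B) qa R
  chordedPathAtHead {Q = Q} p q∈T deg N⊆ with chordAt Q deg (N-⊆-tail N⊆)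
  ... | b , B , qa , R , refl , q~qa , chord =
    b , B , qa , R , refl , record { path = p ; q∈T = q∈T ; q~qa = q~qa ; chord = chord }

  K4Minor-ofCrossing : ∀ {q b B qa R} → ChordedPath q (b ∷ B) qa R →
                       Any (λ x → Any (Adj G x) R) (b ∷ B) → HasK4Minor G
  K4Minor-ofCrossing {q} {b} {B} {qa} cp crossing with find crossing | find (chord cp)
  ... | x , x∈P , x~R | r , r∈R , q~r with find x~R
  ... | y , y∈R , x~y with splitAtFirst (AdjToSome? G (q ∷ b ∷ B)) (lose r∈R (here q~r))
  ... | R₁ , d , R₂ , refl , R₁-missed , _ =
    K4Minor-fromSegments G (q ∷ []) (b ∷ B) (qa ∷ R₁) (d ∷ R₂) (unique (path cp)) [-] l₁ l₂ l₃
      (q , b , here refl , here refl , Linked.head prefix)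
      (q , qa , here refl , here refl , q~qa cp)
      (q , r , here refl , after r∈R (here q~r) , q~r)
      (Linked-++⇒Joined G b B (Linked.tail (linked (path cp))))
      (x , y , x∈P , after y∈R (there (lose x∈P x~y)) , x~y)
      (Linked-++⇒Joined G qa R₁ suffix)
    where
    after : ∀ {v} → v ∈ R₁ ++ d ∷ R₂ → Any (λ x → Adj G x v) (q ∷ b ∷ B) → v ∈ d ∷ R₂
    after = ∈-++⁻-All∁ (AdjToSome? G (q ∷ b ∷ B)) R₁ R₁-missed

    prefix : Linked (Adj G) (q ∷ b ∷ B)
    prefix = proj₁ (Linked-++⁻ (q ∷ b ∷ B) (linked (path cp)))
    suffix : Linked (Adj G) (qa ∷ R₁ ++ d ∷ R₂)
    suffix = proj₂ (Linked-++⁻ (q ∷ b ∷ B) (linked (path cp)))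
    l₁ : Linked (Adj G) (b ∷ B)
    l₁ = Linked.tail prefix
    l₂ : Linked (Adj G) (qa ∷ R₁)
    l₂ = proj₁ (Linked-++⁻ (qa ∷ R₁) suffix)
    l₃ : Linked (Adj G) (d ∷ R₂)
    l₃ = proj₂ (Linked-++⁻ (qa ∷ R₁) suffix)

  record Rerouting (q : Fin n) (P : List (Fin n)) (qa : Fin n) (R : List (Fin n)) : Set where
    field
      u           : Fin n
      Z           : List (Fin n)
      newPath     : IsTPath (u ∷ Z ++ R)
      u∈T         : u ∈ T
      u≁R         : ¬ Any (Adj G u) R
      length-Z    : length Z ≡ suc (length P)
      length-path : length (u ∷ Z ++ R) ≡ length (q ∷ P ++ qa ∷ R)

  reroute : ∀ {q b B qa R} → ChordedPath q (b ∷ B) qa R →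
            ¬ Any (λ x → Any (Adj G x) R) (b ∷ B) → Rerouting q (b ∷ B) qa R
  reroute {q} {b} {B} {qa} {R} cp noCrossing with reverse-∷ b B
  ... | u , M , rev≡ = record
    { u           = u
    ; Z           = M ++ q ∷ qa ∷ []
    ; newPath     = subst IsTPath reshape reversed
    ; u∈T         = All.lookup (ChordedPath-P⊆T cp) u∈P
    ; u≁R         = λ u~R → noCrossing (lose u∈P u~R)
    ; length-Z    = length-Z
    ; length-path = trans (cong length (sym reshape)) (↭-length σ)
    }
    where
    open ≡-Reasoning
    P : List (Fin n)
    P = b ∷ B

    σ : reverse P ++ q ∷ qa ∷ R ↭ q ∷ P ++ qa ∷ R
    σ = ↭-trans (++⁺ʳ (q ∷ qa ∷ R) (↭-reverse P)) (shift q P (qa ∷ R))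

    halves : Linked (Adj G) (q ∷ P) × Linked (Adj G) (qa ∷ R)
    halves = Linked-++⁻ (q ∷ P) (linked (path cp))

    reversed : IsTPath (reverse P ++ q ∷ qa ∷ R)
    reversed = record
      { unique  = Unique-resp-↭ (↭-sym σ) (unique (path cp))
      ; linked  = subst (Linked (Adj G)) (ʳ++-defn P)
                    (Linked-ʳ++ (Adj-sym G) P (proj₁ halves) (q~qa cp ∷ proj₂ halves))
      ; through = ThroughT-++⁺ (All-resp-↭ (↭-sym (↭-reverse P)) (ChordedPath-P⊆T cp))
                    (q∈T cp ∷ proj₂ (ThroughT-++⁻ (q ∷ P) (through (path cp))))
      ; w-safe  = Sum.map₁ (∈-resp-↭ (↭-sym σ)) (w-safe (path cp))
      }

    reshape : reverse P ++ q ∷ qa ∷ R ≡ u ∷ (M ++ q ∷ qa ∷ []) ++ R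
    reshape = begin
      reverse P ++ q ∷ qa ∷ R        ≡⟨ cong (_++ q ∷ qa ∷ R) rev≡ ⟩
      u ∷ M ++ q ∷ qa ∷ R            ≡⟨ cong (u ∷_) (++-assoc M (q ∷ qa ∷ []) R) ⟨
      u ∷ (M ++ q ∷ qa ∷ []) ++ R    ∎

    u∈P : u ∈ P
    u∈P = ∈-resp-↭ (↭-reverse P) (subst (u ∈_) (sym rev≡) (here refl))

    length-Z : length (M ++ q ∷ qa ∷ []) ≡ suc (length P)
    length-Z = begin
      length (M ++ q ∷ qa ∷ [])  ≡⟨ length-++ M ⟩
      length M + 2               ≡⟨ +-comm (length M) 2 ⟩
      suc (length (u ∷ M))       ≡⟨ cong (suc ∘ length) rev≡ ⟨
      suc (length (reverse P))   ≡⟨ cong suc (length-reverse P) ⟩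
      suc (length P)             ∎

  shortcut : ∀ {q P qa R} (rr : Rerouting q P qa R) → let open Rerouting rr in
             3 ≤ length (N u) → N u ⊆ u ∷ Z ++ R →
             ∃₂ λ y B → ∃₂ λ qa′ R′ → ChordedPath u (y ∷ B) qa′ R′ ×
               length (y ∷ B) < length P × length (u ∷ (y ∷ B) ++ qa′ ∷ R′) ≡ length (u ∷ Z ++ R)
  shortcut {P = P} {R = R} rr deg N⊆
    with chordAt Z deg (λ x∈N → ∈-++-∉ʳ Z (N-⊆-tail N⊆ x∈N) (λ x∈R → u≁R (lose x∈R (N-adjacent x∈N))))
    where open Rerouting rr
  ... | y , B , qa′ , R′ , Z≡ , u~qa′ , chord′ =
    y , B , qa′ , R′ ++ R ,
    record { path = subst IsTPath path≡ newPath ; q∈T = u∈T ; q~qa = u~qa′ ; chord = Any.++⁺ˡ chord′ } ,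
    ≤-pred shorter , cong length (sym path≡)
    where
    open Rerouting rr
    path≡ : u ∷ Z ++ R ≡ u ∷ (y ∷ B) ++ qa′ ∷ R′ ++ R
    path≡ = cong (u ∷_) (trans (cong (_++ R) Z≡) (++-assoc (y ∷ B) (qa′ ∷ R′) R))
    shorter : 2 + length (y ∷ B) ≤ suc (length P)
    shorter = ≤-trans (length-++-∷-Any (y ∷ B) chord′) (≤-reflexive (trans (cong length (sym Z≡)) length-Z))

  open Rerouting using (newPath; u∈T; length-path)

  Budget : ℕ → ℕ → Set
  Budget f ℓ = length (w ∷ T) ≤ f + ℓ

  module _ (deg : ∀ {v} → v ∈ T → 3 ≤ degreeIn G (w ∷ T) v) where

    -- A path has at most |T| + 1 vertices, so f bounds the number of further extensions;
    -- g bounds the length of P, which every rerouting shortens.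
    mutual
      K4Minor-fromPath : ∀ f {q Q} → q ∈ T → IsTPath (q ∷ Q) → Budget f (length (q ∷ Q)) → HasK4Minor G
      K4Minor-fromPath f q∈T p fuel with extends-or-N⊆ p q∈T
      ... | inj₁ ext = K4Minor-fromExtension f q∈T p fuel ext
      ... | inj₂ N⊆ with chordedPathAtHead p q∈T (deg q∈T) N⊆
      ... | b , B , _ , _ , refl , cp = K4Minor-fromChordedPath f (length (b ∷ B)) cp ≤-refl fuel

      K4Minor-fromExtension : ∀ f {q Q} → q ∈ T → IsTPath (q ∷ Q) → Budget f (length (q ∷ Q)) →
                              Extends q (q ∷ Q) → HasK4Minor G
      K4Minor-fromExtension zero    q∈T p fuel (x , x∈T , x∉Q , q~x) =
        contradiction (≤-trans (IsTPath-length≤ (extend p x∈T x∉Q q~x)) fuel) 1+n≰n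
      K4Minor-fromExtension (suc f) {q} {Q} q∈T p fuel (x , x∈T , x∉Q , q~x) =
        K4Minor-fromPath f x∈T (extend p x∈T x∉Q q~x) (subst (length (w ∷ T) ≤_) (sym (+-suc f _)) fuel)

      K4Minor-fromChordedPath : ∀ f g {q b B qa R} → ChordedPath q (b ∷ B) qa R → length (b ∷ B) ≤ g →
                                Budget f (length (q ∷ (b ∷ B) ++ qa ∷ R)) → HasK4Minor G
      K4Minor-fromChordedPath f zero    _ () _
      K4Minor-fromChordedPath f (suc g) {b = b} {B} {R = R} cp |P|≤g fuel
        with any? (λ x → any? (Adj? G x) R) (b ∷ B)
      ... | yes crossing = K4Minor-ofCrossing cp crossing
      ... | no noCrossing with reroute cp noCrossing
      ... | rr with extends-or-N⊆ (newPath rr) (u∈T rr)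
      ... | inj₁ ext =
        K4Minor-fromExtension f (u∈T rr) (newPath rr) (subst (Budget f) (sym (length-path rr)) fuel) ext
      ... | inj₂ N⊆ with shortcut rr (deg (u∈T rr)) N⊆
      ... | _ , _ , _ , _ , cp′ , shorter , same =
        K4Minor-fromChordedPath f g cp′ (≤-pred (≤-trans shorter |P|≤g))
          (subst (Budget f) (sym (trans same (length-path rr))) fuel)

    K4Minor-ofMinDegree3 : ∀ {t} → t ∈ T → HasK4Minor G
    K4Minor-ofMinDegree3 {t} t∈T with any? (λ v → Adj? G v w) T
    ... | yes someNbr with find someNbr
    ... | v , v∈T , v~w = K4Minor-fromPath (length (w ∷ T)) v∈T vw (m≤m+n _ _)
      where
      v≢w : v ≢ w
      v≢w v≡w = Unique[x∷xs]⇒x∉xs w∷T-unique (subst (_∈ T) v≡w v∈T)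
      vw : IsTPath (v ∷ w ∷ [])
      vw = record
        { unique  = (v≢w ∷ []) ∷ [] ∷ []
        ; linked  = v~w ∷ [-]
        ; through = v∈T ∷ [w]
        ; w-safe  = inj₁ (there (here refl))
        }
    K4Minor-ofMinDegree3 {t} t∈T | no noNbr = K4Minor-fromPath (length (w ∷ T)) t∈T single (m≤m+n _ _)
      where
      single : IsTPath (t ∷ [])
      single = record
        { unique  = [] ∷ []
        ; linked  = [-]
        ; through = t∈T ∷ []
        ; w-safe  = inj₂ (λ v∈T v~w → noNbr (lose v∈T v~w))
        }

module _ {n : ℕ} (G : Graph n) (L : ListAssignment n) where

  IsListColouring : List (Fin n) → (Fin n → ℕ) → Set
  IsListColouring X f = (∀ {v} → v ∈ X → f v ∈ L v) × (∀ {u v} → u ∈ X → v ∈ X → Adj G u v → f u ≢ f v)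

  _-ᵥ_ : List (Fin n) → Fin n → List (Fin n)
  X -ᵥ v = filter (λ x → ¬? (x ≟ᶠ v)) X

  recolour : (Fin n → ℕ) → Fin n → ℕ → Fin n → ℕ
  recolour f v c x with x ≟ᶠ v
  ... | yes _ = c
  ... | no  _ = f x

  extendColouring : ∀ {X v f} → Unique (L v) → degreeIn G X v < length (L v) →
                    IsListColouring (X -ᵥ v) f → ∃ (IsListColouring X)
  extendColouring {X} {v} {f} L-unique few (inL , proper)
    with all? (_∈ℕ? map f (filterᵇ (adj G v) X)) (L v)
  ... | yes L⊆used = contradiction (Unique-⊆⇒length≤ L-unique (All.lookup L⊆used))
                       (<⇒≱ (subst (_< length (L v)) (sym (length-map f (filterᵇ (adj G v) X))) few))
  ... | no L⊈used with find (¬All⇒Any¬ (_∈ℕ? map f (filterᵇ (adj G v) X)) (L v) L⊈used)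
  ... | c , c∈L , c∉used = recolour f v c , inL′ , proper′
    where
    remaining : ∀ {x} → x ∈ X → x ≢ v → x ∈ X -ᵥ v
    remaining x∈X x≢v = ∈-filter⁺ (λ x → ¬? (x ≟ᶠ v)) x∈X x≢v

    c≢neighbour : ∀ {x} → x ∈ X → x ≢ v → Adj G v x → c ≢ f x
    c≢neighbour x∈X x≢v v~x c≡fx =
      c∉used (subst (_∈ map f (filterᵇ (adj G v) X)) (sym c≡fx)
                    (∈-map⁺ f (∈-filter⁺ (T? ∘ adj G v) x∈X v~x)))

    inL′ : ∀ {x} → x ∈ X → recolour f v c x ∈ L x
    inL′ {x} x∈X with x ≟ᶠ v
    ... | yes refl = c∈L
    ... | no x≢v   = inL (remaining x∈X x≢v)

    proper′ : ∀ {x y} → x ∈ X → y ∈ X → Adj G x y → recolour f v c x ≢ recolour f v c y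
    proper′ {x} {y} x∈X y∈X x~y with x ≟ᶠ v | y ≟ᶠ v
    ... | yes refl | yes refl = contradiction x~y (Adj-irrefl G)
    ... | yes refl | no y≢v   = c≢neighbour y∈X y≢v x~y
    ... | no x≢v   | yes refl = c≢neighbour x∈X x≢v (Adj-sym G x~y) ∘ sym
    ... | no x≢v   | no y≢v   = proper (remaining x∈X x≢v) (remaining y∈X y≢v) x~y

  Degenerate : List (Fin n) → Set
  Degenerate X = ∀ {Y t} → Unique Y → Y ⊆ X → t ∈ Y → Any (λ v → degreeIn G Y v < length (L v)) Y

  degenerate⇒colourable : ∀ {X} → Degenerate X → (∀ {v} → v ∈ X → Unique (L v)) → Unique X →
                          ∃ (IsListColouring X)
  degenerate⇒colourable {X} degenerate L-unique X-unique =
    colourSublist (length X) ≤-refl X-unique (λ x∈X → x∈X)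
    where
    colourSublist : ∀ k {Y} → length Y ≤ k → Unique Y → Y ⊆ X → ∃ (IsListColouring Y)
    colourSublist _       {[]}    _    _        _    = (λ _ → 0) , (λ ()) , (λ ())
    colourSublist zero    {_ ∷ _} ()   _        _
    colourSublist (suc k) {Y@(_ ∷ _)} |Y|≤ Y-unique Y⊆X with find (degenerate Y-unique Y⊆X (here refl))
    ... | v , v∈Y , few =
      extendColouring (L-unique (Y⊆X v∈Y)) few
        (proj₂ (colourSublist k (≤-pred (≤-trans shrinks |Y|≤))
          (Unique.filter⁺ (λ x → ¬? (x ≟ᶠ v)) Y-unique) (Y⊆X ∘ proj₁ ∘ ∈-filter⁻ (λ x → ¬? (x ≟ᶠ v)))))
      where
      shrinks : length (Y -ᵥ v) < length Y
      shrinks = filter-notAll (λ x → ¬? (x ≟ᶠ v)) Y (lose v∈Y (λ v≢v → v≢v refl))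

module _ {n : ℕ} (S : VSet n) where

  members : List (Fin n)
  members = filterᵇ S (allFin n)

  members-unique : Unique members
  members-unique = Unique.filter⁺ (T? ∘ S) (allFin⁺ n)

  ∈-members⁺ : ∀ {v} → v ∈ₛ S → v ∈ members
  ∈-members⁺ v∈S = ∈-filter⁺ (T? ∘ S) (∈-allFin _) v∈S

  ∈-members⁻ : ∀ {v} → v ∈ members → v ∈ₛ S
  ∈-members⁻ v∈ = proj₂ (∈-filter⁻ (T? ∘ S) {xs = allFin n} v∈)

module _ {n : ℕ} (G : Graph n) (S : VSet n) {w : Fin n} (w∉S : w ∉ₛ S)
         (onlyW : ∀ x → InCoboundary G S x → x ≡ w) (L : ListAssignment n)
         (boundary≥2 : ∀ v → InBoundary G S v → length (L v) ≥ 2)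
         (interior≥4 : ∀ v → v ∈ₛ S → ¬ InBoundary G S v → length (L v) ≥ 4) where

  degreeIn-w∷≥3 : ∀ {Y v} → v ∈ₛ S → length (L v) ≤ degreeIn G Y v → 3 ≤ degreeIn G (w ∷ Y) v
  degreeIn-w∷≥3 {Y} {v} v∈S L≤deg with Adj? G v w
  ... | yes v~w = begin
    3                     ≤⟨ s≤s (boundary≥2 v (v∈S , w , w∉S , v~w)) ⟩
    suc (length (L v))    ≤⟨ s≤s L≤deg ⟩
    suc (degreeIn G Y v)  ≡⟨ cong length (filter-accept (T? ∘ adj G v) v~w) ⟨
    degreeIn G (w ∷ Y) v  ∎
    where open ≤-Reasoning
  ... | no v≁w = begin
    3                     ≤⟨ n≤1+n 3 ⟩
    4                     ≤⟨ interior≥4 v v∈S interior ⟩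
    length (L v)          ≤⟨ L≤deg ⟩
    degreeIn G Y v        ≡⟨ cong length (filter-reject (T? ∘ adj G v) v≁w) ⟨
    degreeIn G (w ∷ Y) v  ∎
    where
    open ≤-Reasoning
    interior : ¬ InBoundary G S v
    interior (_ , x , x∉S , v~x) = v≁w (subst (Adj G v) (onlyW x (x∉S , v , v∈S , Adj-sym G v~x)) v~x)

  pocket-degenerate : K4MinorFree G → Degenerate G L (members S)
  pocket-degenerate k4free {Y} {t} Y-unique Y⊆S t∈Y with any? (λ v → degreeIn G Y v <? length (L v)) Y
  ... | yes found = found
  ... | no none =
    contradiction (K4FromMinDegree.K4Minor-ofMinDegree3 G w Y w∷Y-unique degreeIn-w∷Y≥3 t∈Y) k4free
    where
    w∷Y-unique : Unique (w ∷ Y)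
    w∷Y-unique = ¬Any⇒All¬ Y (λ w∈Y → w∉S (∈-members⁻ S (Y⊆S w∈Y))) ∷ Y-unique

    degreeIn-w∷Y≥3 : ∀ {v} → v ∈ Y → 3 ≤ degreeIn G (w ∷ Y) v
    degreeIn-w∷Y≥3 v∈Y = degreeIn-w∷≥3 (∈-members⁻ S (Y⊆S v∈Y)) (≮⇒≥ (λ few → none (lose v∈Y few)))

mainTheorem9 : ∀ {n} (G : Graph n) → K4MinorFree G → (C : ℕ) → 1 ≤ C →
    (S : VSet n) → IsPocket G C S → CoboundarySizeOne G S →
    (L : ListAssignment n) →
    (∀ v → v ∈ₛ S → Unique (L v)) →
    (∀ v → InBoundary G S v → length (L v) ≥ 2) →
    (∀ v → v ∈ₛ S → ¬ InBoundary G S v → length (L v) ≥ 4) →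
    ∃ λ (f : Fin n → ℕ) → IsLColouring G S L f
mainTheorem9 G k4free _ _ S _ (w , (w∉S , _) , onlyW) L L-unique boundary≥2 interior≥4
  with degenerate⇒colourable G L (pocket-degenerate G S w∉S onlyW L boundary≥2 interior≥4 k4free)
         (λ v∈ → L-unique _ (∈-members⁻ S v∈)) (members-unique S)
... | f , inL , proper =
  f , (λ v v∈S → inL (∈-members⁺ S v∈S)) ,
      (λ u v u∈S v∈S → proper (∈-members⁺ S u∈S) (∈-members⁺ S v∈S))
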